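{- Let $\lambda$ be a nonzero real number. For integers $n\ge 0$ let $(x)_{0,\lambda}=1$ and $(x)_{n,\lambda}=x(x-\lambda)\cdots(x-(n-1)\lambda)$ for $n\ge1$. Define the degenerate Eulerian polynomials by $\sum_{j=0}^{\infty}(j+1)_{n,\lambda}x^{j}=\frac{A_{n,\lambda}(x)}{(1-x)^{n+1}}$ for $|x|<1$, and the degenerate Eulerian numbers by $A_{n,\lambda}(x)=\sum_{k=0}^{n}A_{\lambda}(n,k)x^{k}$, with the convention $A_\lambda(n,k)=0$ if $k<0$ or $k>n$. Then for $n\ge1$ and $0\le k\le n$, \[A_{\lambda}(n,k)=\big((n-k)+(n-1)\lambda\big)A_{\lambda}(n-1,k-1)+\big(k+1-(n-1)\lambda\big)A_{\lambda}(n-1,k).\] -}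

module Defs where

open import Level using (Level)
open import Algebra.Bundles using (CommutativeRing)
open import Data.Nat using (ℕ; zero; suc; _∸_; _≤?_)
open import Data.Integer using (ℤ; +_; -[1+_])
open import Relation.Nullary using (yes; no)

module _ {c ℓ : Level} (R : CommutativeRing c ℓ) where
  open CommutativeRing R using (Carrier; 0#; 1#; _+_; _*_; -_; _-_)

  ℕ→R : ℕ → Carrier
  ℕ→R zero    = 0#
  ℕ→R (suc n) = 1# + ℕ→R n

  fallλ : Carrier → Carrier → ℕ → Carrier
  fallλ lam x zero    = 1#
  fallλ lam x (suc n) = fallλ lam x n * (x - ℕ→R n * lam)

  Series : Set c
  Series = ℕ → Carrier

  sumTo : (ℕ → Carrier) → ℕ → Carrier
  sumTo f zero    = f zero
  sumTo f (suc k) = sumTo f k + f (suc k)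

  conv : Series → Series → Series
  conv f g k = sumTo (λ i → f i * g (k ∸ i)) k

  oneMinusX : Series
  oneMinusX zero          = 1#
  oneMinusX (suc zero)    = - 1#
  oneMinusX (suc (suc _)) = 0#

  oneS : Series
  oneS zero    = 1#
  oneS (suc _) = 0#

  powS : Series → ℕ → Series
  powS f zero    = oneS
  powS f (suc n) = conv (powS f n) f

  genSeries : Carrier → ℕ → Series
  genSeries lam n j = fallλ lam (ℕ→R (suc j)) n

  -- A_{n,λ}(x) = (1-x)^{n+1} Σ_j (j+1)_{n,λ} x^j, as a formal power series
  eulerPolyλ : Carrier → ℕ → Series
  eulerPolyλ lam n = conv (powS oneMinusX (suc n)) (genSeries lam n)

  Aλ : Carrier → ℕ → ℤ → Carrier
  Aλ lam n -[1+ _ ] = 0#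
  Aλ lam n (+ k) with k ≤? n
  ... | yes _ = eulerPolyλ lam n k
  ... | no  _ = 0#

-- Writing g_n(j) = (j+1)_{n,λ}, multiplication by (1 - x) is the backward
-- difference Δ on coefficient sequences, so A_{n,λ} = Δ^{n+1} g_n coefficientwise.
-- Since g_{n+1}(j) = (j + 1 - nλ) g_n(j), the recurrence comes from commuting
-- Δ^{m+1} past multiplication by the linear weight j + 1 - c, which produces the
-- extra term (m+1) Δ^m g(j-1).  The same recurrence shows that the coefficients
-- beyond degree n vanish, so A_{n,λ} really is a polynomial of degree ≤ n.
module Submission where

open import Defs
open import Level using (Level)
open import Algebra.Bundles using (CommutativeRing; Ring)
open import Data.Nat as ℕ using (ℕ; zero; suc; _∸_; _≤_; _<_; s≤s; _≤?_)
import Data.Nat.Properties as ℕ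
open import Data.Integer using (+_) renaming (_-_ to _-ℤ_)
open import Relation.Nullary using (¬_; yes; no)
import Relation.Binary.PropositionalEquality as ≡
import Relation.Binary.Reasoning.Setoid as SetoidReasoning

module DegenerateEulerian {c ℓ} (R : CommutativeRing c ℓ) where
  open CommutativeRing R hiding (zero)
  open import Algebra.Properties.Ring ring using (-1*x≈-x)
  open import Algebra.Properties.RingWithoutOne (Ring.ringWithoutOne ring) using (x[y-z]≈xy-xz; [y-z]x≈yx-zx)
  open import Algebra.Properties.Group +-group using (ε⁻¹≈ε; ⁻¹-involutive; ⁻¹-anti-homo-∙; //-rightDividesˡ; //-rightDividesʳ)
  open import Algebra.Properties.AbelianGroup +-abelianGroup using (⁻¹-∙-comm)
  open import Algebra.Properties.CommutativeSemigroup +-commutativeSemigroup using (interchange)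
  open SetoidReasoning setoid

  private
    ⌜_⌝ : ℕ → Carrier
    ⌜_⌝ = ℕ→R R

  infix 4 _≋_
  _≋_ : Series R → Series R → Set ℓ
  f ≋ g = ∀ k → f k ≈ g k

  ℕ→R-+ : ∀ m n → ⌜ m ℕ.+ n ⌝ ≈ ⌜ m ⌝ + ⌜ n ⌝
  ℕ→R-+ zero    n = sym (+-identityˡ _)
  ℕ→R-+ (suc m) n = trans (+-congˡ (ℕ→R-+ m n)) (sym (+-assoc _ _ _))

  ℕ→R-∸ : ∀ {m n} → n ≤ m → ⌜ m ⌝ - ⌜ n ⌝ ≈ ⌜ m ∸ n ⌝
  ℕ→R-∸ {m} {n} n≤m = begin
    ⌜ m ⌝ - ⌜ n ⌝                ≡⟨ ≡.cong (λ l → ⌜ l ⌝ - ⌜ n ⌝) (≡.sym (ℕ.m∸n+n≡m n≤m)) ⟩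
    ⌜ m ∸ n ℕ.+ n ⌝ - ⌜ n ⌝      ≈⟨ +-congʳ (ℕ→R-+ (m ∸ n) n) ⟩
    ⌜ m ∸ n ⌝ + ⌜ n ⌝ - ⌜ n ⌝    ≈⟨ //-rightDividesʳ ⌜ n ⌝ ⌜ m ∸ n ⌝ ⟩
    ⌜ m ∸ n ⌝                    ∎

  -‿interchange : ∀ a b c d → (a - b) + (c - d) ≈ (a + c) - (b + d)
  -‿interchange a b c d = trans (interchange a (- b) c (- d)) (+-congˡ (⁻¹-∙-comm b d))

  1+w*x≈x+w*x : ∀ w x → (1# + w) * x ≈ x + w * x
  1+w*x≈x+w*x w x = trans (distribʳ x 1# w) (+-congʳ (*-identityˡ x))

  x-[y-z]≈x-y+z : ∀ x y z → x - (y - z) ≈ (x - y) + z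
  x-[y-z]≈x-y+z x y z = begin
    x - (y - z)       ≈⟨ +-congˡ (sym (⁻¹-∙-comm y (- z))) ⟩
    x + (- y + - - z) ≈⟨ +-congˡ (+-congˡ (⁻¹-involutive z)) ⟩
    x + (- y + z)     ≈⟨ sym (+-assoc x (- y) z) ⟩
    (x - y) + z       ∎

  sumTo-cong-≤ : ∀ {f g} k → (∀ i → i ≤ k → f i ≈ g i) → sumTo R f k ≈ sumTo R g k
  sumTo-cong-≤ zero    f≈g = f≈g 0 ℕ.z≤n
  sumTo-cong-≤ (suc k) f≈g =
    +-cong (sumTo-cong-≤ k (λ i i≤k → f≈g i (ℕ.m≤n⇒m≤1+n i≤k))) (f≈g (suc k) ℕ.≤-refl)

  sumTo-cong : ∀ {f g} k → f ≋ g → sumTo R f k ≈ sumTo R g k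
  sumTo-cong k f≋g = sumTo-cong-≤ k (λ i _ → f≋g i)

  sumTo-sucˡ : ∀ f k → sumTo R f (suc k) ≈ f 0 + sumTo R (λ i → f (suc i)) k
  sumTo-sucˡ f zero    = refl
  sumTo-sucˡ f (suc k) = trans (+-congʳ (sumTo-sucˡ f k)) (+-assoc _ _ _)

  sumTo-reverse : ∀ f k → sumTo R f k ≈ sumTo R (λ i → f (k ∸ i)) k
  sumTo-reverse f zero    = refl
  sumTo-reverse f (suc k) = begin
    sumTo R f k + f (suc k)                       ≈⟨ +-congʳ (sumTo-reverse f k) ⟩
    sumTo R (λ i → f (k ∸ i)) k + f (suc k)       ≈⟨ +-comm _ _ ⟩
    f (suc k) + sumTo R (λ i → f (k ∸ i)) k       ≈⟨ sumTo-sucˡ (λ i → f (suc k ∸ i)) k ⟨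
    sumTo R (λ i → f (suc k ∸ i)) (suc k)         ∎

  sumTo-zero : ∀ {f} k → f ≋ (λ _ → 0#) → sumTo R f k ≈ 0#
  sumTo-zero zero    f≋0 = f≋0 0
  sumTo-zero (suc k) f≋0 = trans (+-cong (sumTo-zero k f≋0) (f≋0 (suc k))) (+-identityʳ 0#)

  sumTo-sub : ∀ f g k → sumTo R (λ i → f i - g i) k ≈ sumTo R f k - sumTo R g k
  sumTo-sub f g zero    = refl
  sumTo-sub f g (suc k) = trans (+-congʳ (sumTo-sub f g k)) (-‿interchange _ _ _ _)

  conv-cong : ∀ {f f′ g g′} → f ≋ f′ → g ≋ g′ → conv R f g ≋ conv R f′ g′
  conv-cong f≋f′ g≋g′ k = sumTo-cong k (λ i → *-cong (f≋f′ i) (g≋g′ (k ∸ i)))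

  conv-comm : ∀ f g → conv R f g ≋ conv R g f
  conv-comm f g k = begin
    sumTo R (λ i → f i * g (k ∸ i)) k                ≈⟨ sumTo-reverse _ k ⟩
    sumTo R (λ i → f (k ∸ i) * g (k ∸ (k ∸ i))) k    ≈⟨ sumTo-cong-≤ k swap ⟩
    sumTo R (λ i → g i * f (k ∸ i)) k                ∎
    where
    swap : ∀ i → i ≤ k → f (k ∸ i) * g (k ∸ (k ∸ i)) ≈ g i * f (k ∸ i)
    swap i i≤k = trans (*-comm _ _) (reflexive (≡.cong (λ j → g j * f (k ∸ i)) (ℕ.m∸[m∸n]≡n i≤k)))

  conv-identityˡ : ∀ g → conv R (oneS R) g ≋ g
  conv-identityˡ g zero    = *-identityˡ _
  conv-identityˡ g (suc k) = begin
    conv R (oneS R) g (suc k)                          ≈⟨ sumTo-sucˡ _ k ⟩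
    1# * g (suc k) + sumTo R (λ i → 0# * g (k ∸ i)) k  ≈⟨ +-cong (*-identityˡ _) (sumTo-zero k (λ _ → zeroˡ _)) ⟩
    g (suc k) + 0#                                     ≈⟨ +-identityʳ _ ⟩
    g (suc k)                                          ∎

  shift : Series R → Series R
  shift g zero    = 0#
  shift g (suc k) = g k

  Δ : Series R → Series R
  Δ g zero    = g zero
  Δ g (suc k) = g (suc k) - g k

  Δⁿ : ℕ → Series R → Series R
  Δⁿ zero    g = g
  Δⁿ (suc m) g = Δ (Δⁿ m g)

  weighted : Carrier → Series R → Series R
  weighted c g j = (⌜ suc j ⌝ - c) * g j

  shift-cong : ∀ {f g} → f ≋ g → shift f ≋ shift g
  shift-cong f≋g zero    = refl
  shift-cong f≋g (suc k) = f≋g k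

  Δ-cong : ∀ {f g} → f ≋ g → Δ f ≋ Δ g
  Δ-cong f≋g zero    = f≋g 0
  Δ-cong f≋g (suc k) = +-cong (f≋g (suc k)) (-‿cong (f≋g k))

  Δⁿ-cong : ∀ m {f g} → f ≋ g → Δⁿ m f ≋ Δⁿ m g
  Δⁿ-cong zero    f≋g = f≋g
  Δⁿ-cong (suc m) f≋g = Δ-cong (Δⁿ-cong m f≋g)

  Δ≋id-shift : ∀ g → Δ g ≋ λ k → g k - shift g k
  Δ≋id-shift g zero    = sym (trans (+-congˡ ε⁻¹≈ε) (+-identityʳ _))
  Δ≋id-shift g (suc k) = refl

  Δ-shift-comm : ∀ g → Δ (shift g) ≋ shift (Δ g)
  Δ-shift-comm g zero          = refl
  Δ-shift-comm g (suc zero)    = sym (Δ≋id-shift g zero)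
  Δ-shift-comm g (suc (suc k)) = refl

  Δ-+ : ∀ f g → Δ (λ j → f j + g j) ≋ λ k → Δ f k + Δ g k
  Δ-+ f g zero    = refl
  Δ-+ f g (suc k) = sym (-‿interchange _ _ _ _)

  Δ-*ˡ : ∀ a g → Δ (λ j → a * g j) ≋ λ k → a * Δ g k
  Δ-*ˡ a g zero    = refl
  Δ-*ˡ a g (suc k) = sym (x[y-z]≈xy-xz a _ _)

  Δ-weighted : ∀ c g → Δ (weighted c g) ≋ λ k → weighted c (Δ g) k + shift g k
  Δ-weighted c g zero    = sym (+-identityʳ _)
  Δ-weighted c g (suc k) = begin
    (⌜ suc (suc k) ⌝ - c) * g (suc k) - w * g k      ≈⟨ +-congʳ (*-congʳ (+-assoc 1# ⌜ suc k ⌝ (- c))) ⟩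
    (1# + w) * g (suc k) - w * g k                   ≈⟨ regroup (g (suc k)) (g k) ⟨
    (1# + w) * (g (suc k) - g k) + g k               ≈⟨ +-congʳ (*-congʳ (+-assoc 1# ⌜ suc k ⌝ (- c))) ⟨
    (⌜ suc (suc k) ⌝ - c) * (g (suc k) - g k) + g k  ∎
    where
    w : Carrier
    w = ⌜ suc k ⌝ - c
    regroup : ∀ x y → (1# + w) * (x - y) + y ≈ (1# + w) * x - w * y
    regroup x y = begin
      (1# + w) * (x - y) + y                 ≈⟨ +-congʳ (x[y-z]≈xy-xz (1# + w) x y) ⟩
      ((1# + w) * x - (1# + w) * y) + y      ≈⟨ +-assoc _ _ _ ⟩
      (1# + w) * x + (- ((1# + w) * y) + y)  ≈⟨ +-congˡ (+-congʳ (-‿cong (1+w*x≈x+w*x w y))) ⟩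
      (1# + w) * x + (- (y + w * y) + y)     ≈⟨ +-congˡ (+-congʳ (⁻¹-anti-homo-∙ y (w * y))) ⟩
      (1# + w) * x + ((- (w * y) - y) + y)   ≈⟨ +-congˡ (//-rightDividesˡ y (- (w * y))) ⟩
      (1# + w) * x - w * y                   ∎

  Δⁿ-weighted : ∀ m c g → Δⁿ (suc m) (weighted c g) ≋
    λ k → weighted c (Δⁿ (suc m) g) k + ⌜ suc m ⌝ * shift (Δⁿ m g) k
  Δⁿ-weighted zero c g k =
    trans (Δ-weighted c g k) (+-congˡ (sym (trans (*-congʳ (+-identityʳ 1#)) (*-identityˡ _))))
  Δⁿ-weighted (suc m) c g k = begin
    Δ (Δⁿ (suc m) (weighted c g)) k                          ≈⟨ Δ-cong (Δⁿ-weighted m c g) k ⟩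
    Δ (λ j → weighted c b j + M * shift (Δⁿ m g) j) k        ≈⟨ Δ-+ _ _ k ⟩
    Δ (weighted c b) k + Δ (λ j → M * shift (Δⁿ m g) j) k    ≈⟨ +-congˡ (Δ-*ˡ M _ k) ⟩
    Δ (weighted c b) k + M * Δ (shift (Δⁿ m g)) k            ≈⟨ +-cong (Δ-weighted c b k) (*-congˡ (Δ-shift-comm _ k)) ⟩
    (weighted c (Δ b) k + shift b k) + M * shift b k         ≈⟨ +-assoc _ _ _ ⟩
    weighted c (Δ b) k + (shift b k + M * shift b k)         ≈⟨ +-congˡ (1+w*x≈x+w*x M (shift b k)) ⟨
    weighted c (Δ b) k + (1# + M) * shift b k                ∎
    where
    b : Series R
    b = Δⁿ (suc m) g
    M : Carrier
    M = ⌜ suc m ⌝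

  Δⁿ-weighted-recurrence : ∀ m c g k → let b = Δⁿ m g in
    Δⁿ (suc m) (weighted c g) k ≈
      ((⌜ suc m ⌝ - ⌜ suc k ⌝) + c) * shift b k + (⌜ suc k ⌝ - c) * b k
  Δⁿ-weighted-recurrence m c g k = begin
    Δⁿ (suc m) (weighted c g) k                   ≈⟨ Δⁿ-weighted m c g k ⟩
    w * Δ b k + M * shift b k                     ≈⟨ +-congʳ (*-congˡ (Δ≋id-shift b k)) ⟩
    w * (b k - shift b k) + M * shift b k         ≈⟨ +-congʳ (x[y-z]≈xy-xz w _ _) ⟩
    (w * b k - w * shift b k) + M * shift b k     ≈⟨ +-assoc _ _ _ ⟩
    w * b k + (- (w * shift b k) + M * shift b k) ≈⟨ +-congˡ (+-comm _ _) ⟩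
    w * b k + (M * shift b k - w * shift b k)     ≈⟨ +-congˡ ([y-z]x≈yx-zx (shift b k) M w) ⟨
    w * b k + (M - w) * shift b k                 ≈⟨ +-congˡ (*-congʳ (x-[y-z]≈x-y+z M ⌜ suc k ⌝ c)) ⟩
    w * b k + ((M - ⌜ suc k ⌝) + c) * shift b k   ≈⟨ +-comm _ _ ⟩
    ((M - ⌜ suc k ⌝) + c) * shift b k + w * b k   ∎
    where
    b : Series R
    b = Δⁿ m g
    M w : Carrier
    M = ⌜ suc m ⌝
    w = ⌜ suc k ⌝ - c

  conv-oneMinusX : ∀ g → conv R (oneMinusX R) g ≋ Δ g
  conv-oneMinusX g zero          = *-identityˡ _
  conv-oneMinusX g (suc zero)    = +-cong (*-identityˡ _) (-1*x≈-x _)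
  conv-oneMinusX g (suc (suc k)) = begin
    conv R (oneMinusX R) g (suc (suc k))                          ≈⟨ sumTo-sucˡ _ (suc k) ⟩
    1# * g (suc (suc k)) + sumTo R (λ i → oneMinusX R (suc i) * g (suc k ∸ i)) (suc k)
      ≈⟨ +-cong (*-identityˡ _) (sumTo-sucˡ _ k) ⟩
    g (suc (suc k)) + (- 1# * g (suc k) + sumTo R (λ i → 0# * g (k ∸ i)) k)
      ≈⟨ +-congˡ (+-cong (-1*x≈-x _) (sumTo-zero k (λ _ → zeroˡ _))) ⟩
    g (suc (suc k)) + (- g (suc k) + 0#)                         ≈⟨ +-congˡ (+-identityʳ _) ⟩
    g (suc (suc k)) - g (suc k)                                   ∎

  conv-Δ : ∀ f g → conv R (Δ f) g ≋ Δ (conv R f g)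
  conv-Δ f g zero    = refl
  conv-Δ f g (suc k) = begin
    conv R (Δ f) g (suc k)                                             ≈⟨ sumTo-sucˡ _ k ⟩
    f 0 * g (suc k) + sumTo R (λ i → (f (suc i) - f i) * g (k ∸ i)) k
      ≈⟨ +-congˡ (sumTo-cong k (λ i → [y-z]x≈yx-zx (g (k ∸ i)) (f (suc i)) (f i))) ⟩
    f 0 * g (suc k) + sumTo R (λ i → f (suc i) * g (k ∸ i) - f i * g (k ∸ i)) k
      ≈⟨ +-congˡ (sumTo-sub _ _ k) ⟩
    f 0 * g (suc k) + (sumTo R (λ i → f (suc i) * g (k ∸ i)) k - conv R f g k)
      ≈⟨ +-assoc _ _ _ ⟨
    (f 0 * g (suc k) + sumTo R (λ i → f (suc i) * g (k ∸ i)) k) - conv R f g k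
      ≈⟨ +-congʳ (sumTo-sucˡ _ k) ⟨
    conv R f g (suc k) - conv R f g k                                  ∎

  conv-powS-oneMinusX : ∀ m g → conv R (powS R (oneMinusX R) m) g ≋ Δⁿ m g
  conv-powS-oneMinusX zero    g = conv-identityˡ g
  conv-powS-oneMinusX (suc m) g k = begin
    conv R (conv R P (oneMinusX R)) g k  ≈⟨ conv-cong {g = g} P·[1-x]≋ΔP (λ _ → refl) k ⟩
    conv R (Δ P) g k                     ≈⟨ conv-Δ P g k ⟩
    Δ (conv R P g) k                     ≈⟨ Δ-cong (conv-powS-oneMinusX m g) k ⟩
    Δ (Δⁿ m g) k                         ∎
    where
    P : Series R
    P = powS R (oneMinusX R) m
    P·[1-x]≋ΔP : conv R P (oneMinusX R) ≋ Δ P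
    P·[1-x]≋ΔP j = trans (conv-comm P (oneMinusX R) j) (conv-oneMinusX P j)

  module _ (lam : Carrier) where

    genSeries-suc : ∀ n → genSeries R lam (suc n) ≋ weighted (⌜ n ⌝ * lam) (genSeries R lam n)
    genSeries-suc n j = *-comm _ _

    eulerPolyλ≋Δⁿ : ∀ n → eulerPolyλ R lam n ≋ Δⁿ (suc n) (genSeries R lam n)
    eulerPolyλ≋Δⁿ n = conv-powS-oneMinusX (suc n) (genSeries R lam n)

    eulerPolyλ-suc : ∀ n k → let a = eulerPolyλ R lam n in
      eulerPolyλ R lam (suc n) k ≈
        ((⌜ suc (suc n) ⌝ - ⌜ suc k ⌝) + ⌜ n ⌝ * lam) * shift a k + (⌜ suc k ⌝ - ⌜ n ⌝ * lam) * a k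
    eulerPolyλ-suc n k = begin
      eulerPolyλ R lam (suc n) k                            ≈⟨ eulerPolyλ≋Δⁿ (suc n) k ⟩
      Δⁿ (suc (suc n)) (genSeries R lam (suc n)) k          ≈⟨ Δⁿ-cong (suc (suc n)) (genSeries-suc n) k ⟩
      Δⁿ (suc (suc n)) (weighted nλ (genSeries R lam n)) k  ≈⟨ Δⁿ-weighted-recurrence (suc n) nλ _ k ⟩
      α * shift b k + β * b k
        ≈⟨ +-cong (*-congˡ (shift-cong (eulerPolyλ≋Δⁿ n) k)) (*-congˡ (eulerPolyλ≋Δⁿ n k)) ⟨
      α * shift (eulerPolyλ R lam n) k + β * eulerPolyλ R lam n k ∎
      where
      nλ α β : Carrier
      nλ = ⌜ n ⌝ * lam
      α = (⌜ suc (suc n) ⌝ - ⌜ suc k ⌝) + nλ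
      β = ⌜ suc k ⌝ - nλ
      b : Series R
      b = Δⁿ (suc n) (genSeries R lam n)

    eulerPolyλ-vanishes : ∀ n k → n < k → eulerPolyλ R lam n k ≈ 0#
    eulerPolyλ-vanishes zero    (suc k) _ = trans (eulerPolyλ≋Δⁿ 0 (suc k)) (-‿inverseʳ 1#)
    eulerPolyλ-vanishes (suc n) (suc k) (s≤s n<k) = begin
      eulerPolyλ R lam (suc n) (suc k)                                ≈⟨ eulerPolyλ-suc n (suc k) ⟩
      _ * eulerPolyλ R lam n k + _ * eulerPolyλ R lam n (suc k)
        ≈⟨ +-cong (*-congˡ (eulerPolyλ-vanishes n k n<k))
                  (*-congˡ (eulerPolyλ-vanishes n (suc k) (ℕ.m≤n⇒m≤1+n n<k))) ⟩
      _ * 0# + _ * 0#                                                 ≈⟨ +-cong (zeroʳ _) (zeroʳ _) ⟩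
      0# + 0#                                                         ≈⟨ +-identityʳ 0# ⟩
      0#                                                              ∎

    Aλ≈eulerPolyλ : ∀ n k → Aλ R lam n (+ k) ≈ eulerPolyλ R lam n k
    Aλ≈eulerPolyλ n k with k ≤? n
    ... | yes _   = refl
    ... | no  k≰n = sym (eulerPolyλ-vanishes n k (ℕ.≰⇒> k≰n))

    Aλ-pred≈shift : ∀ n k → Aλ R lam n ((+ k) -ℤ (+ 1)) ≈ shift (eulerPolyλ R lam n) k
    Aλ-pred≈shift n zero    = refl
    Aλ-pred≈shift n (suc k) = Aλ≈eulerPolyλ n k

theorem2p6 : ∀ {c ℓ : Level} (R : CommutativeRing c ℓ) →
    let open CommutativeRing R in
    (lam : Carrier) → ¬ (lam ≈ 0#) →
    (n k : ℕ) → k ≤ suc n →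
    Aλ R lam (suc n) (+ k)
      ≈ ((ℕ→R R (suc n ∸ k) + ℕ→R R n * lam) * Aλ R lam n ((+ k) -ℤ (+ 1)))
        + ((ℕ→R R (suc k) - ℕ→R R n * lam) * Aλ R lam n (+ k))
theorem2p6 R lam _ n k k≤1+n = begin
  Aλ R lam (suc n) (+ k)      ≈⟨ Aλ≈eulerPolyλ lam (suc n) k ⟩
  eulerPolyλ R lam (suc n) k  ≈⟨ eulerPolyλ-suc lam n k ⟩
  ((ℕ→R R (suc (suc n)) - ℕ→R R (suc k)) + nλ) * shift (eulerPolyλ R lam n) k
    + (ℕ→R R (suc k) - nλ) * eulerPolyλ R lam n k
    ≈⟨ +-cong (*-cong (+-congʳ (ℕ→R-∸ (s≤s k≤1+n))) (sym (Aλ-pred≈shift lam n k)))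
              (*-congˡ (sym (Aλ≈eulerPolyλ lam n k))) ⟩
  (ℕ→R R (suc n ∸ k) + nλ) * Aλ R lam n ((+ k) -ℤ (+ 1)) + (ℕ→R R (suc k) - nλ) * Aλ R lam n (+ k) ∎
  where
  open CommutativeRing R
  open DegenerateEulerian R
  open SetoidReasoning setoid
  nλ : Carrier
  nλ = ℕ→R R n * lam
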